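{- Let $n\ge1$ and let $\Pi_n:\mathrm{R2}\delta_n\to\mathrm{R\Lambda}_n$ be the map that sends a rook placement $R$ on $2\delta_n$ to the rook placement obtained by deleting all columns of $R$ that contain no rook. Then the image $\Pi_n(\mathrm{R2}\delta_n)$ is exactly the set of rook placements $S\in\mathrm{R\Lambda}_n$ in which every block has size at most $2$.
   Context: All Young diagrams are drawn in French notation. The double staircase $2\delta_n$ is the Young diagram of $(2n,2(n-1),\ldots,2)$. $\mathrm{R2}\delta_n$ is the set of placements of $n$ rooks in $2\delta_n$ with exactly one rook per row and at most one rook per column. $\Lambda_n$ is the set of Young diagrams with exactly $n$ rows and $n$ columns. $\mathrm{R\Lambda}_n$ is the set of rook placements in a diagram of $\Lambda_n$ with exactly one rook in each row and exactly one rook in each column. A block of a Young diagram (or of a rook placement on it) is a maximal collection of columns with the same height, and its size is its number of columns. -}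

module Defs where

open import Data.Nat using (ℕ; zero; suc; _+_; _*_; _∸_; _≤_; _<_; _/_)
import Data.Nat as ℕ
open import Data.Fin using (Fin; toℕ)
import Data.Fin as Fin
open import Data.List using (List; length; filter)
open import Data.List.Base using ()
open import Data.Fin.Base using ()
open import Data.Product using (Σ; ∃; _×_; _,_)
open import Function.Definitions using (Injective; Surjective)
open import Relation.Binary.PropositionalEquality using (_≡_)
open import Relation.Nullary using (Dec)
import Data.Fin.Properties as FinP
open import Data.List using (allFin)

-- Conventions (French notation): rows and columns are 0-indexed,
-- row 0 is the bottom row, column 0 is the leftmost column.

count : (n : ℕ) → (P : Fin n → Set) → (∀ i → Dec (P i)) → ℕ
count n P P? = length (filter P? (allFin n))

-- R2δ_n : rook placements on the double staircase 2δ_n = (2n, 2(n-1), …, 2).  A placement is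
-- given by the column of the rook in each row (exactly one rook per row);
-- injectivity = at most one rook per column.

record R2δ (n : ℕ) : Set where
  field
    col    : Fin n → Fin (2 * n)
    inj    : Injective _≡_ _≡_ col
    inside : ∀ r → toℕ (col r) < 2 * (n ∸ toℕ r)

-- Λ_n : Young diagrams with exactly n rows and exactly n columns, given
-- by their column heights h 0 ≥ h 1 ≥ … ≥ h (n-1) ≥ 1, with max height n.

record Λ (n : ℕ) : Set where
  field
    height   : Fin n → ℕ
    weakDec  : ∀ i j → toℕ i ≤ toℕ j → height j ≤ height i
    positive : ∀ j → 1 ≤ height j
    bounded  : ∀ j → height j ≤ n
    reaches  : ∃ λ j → height j ≡ n

-- RΛ_n : a diagram of Λ_n with a rook placement having exactly one rook in
-- each row and exactly one rook in each column.  rook r is the column of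
-- the rook in row r.
record RΛ (n : ℕ) : Set where
  field
    shape  : Λ n
    rook   : Fin n → Fin n
    inj    : Injective _≡_ _≡_ rook
    surj   : ∀ c → ∃ λ r → rook r ≡ c
    inside : ∀ r → toℕ r < Λ.height shape (rook r)

colHeight : ∀ {n} → RΛ n → Fin n → ℕ
colHeight S c = Λ.height (RΛ.shape S) c

-- The map Π_n : delete the columns of R containing no rook.
-- Column c (0-indexed) of 2δ_n has height n - ⌊c/2⌋.  After deleting the
-- empty columns, the column of the rook of row r becomes column number
--   rank R r = #{ rows r' | col r' < col r }
-- (the number of non-empty columns to its left), and keeps its height.
-- Since every column of Π_n(R) contains a rook, these data determine
-- Π_n(R) completely; "Π_n R = S" is the following relation.

rank : ∀ {n} → R2δ n → Fin n → ℕ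
rank {n} R r = count n (λ r' → toℕ (R2δ.col R r') < toℕ (R2δ.col R r))
                       (λ r' → toℕ (R2δ.col R r') ℕ.<? toℕ (R2δ.col R r))

ΠEq : ∀ {n} → R2δ n → RΛ n → Set
ΠEq {n} R S = ∀ r →
  (toℕ (RΛ.rook S r) ≡ rank R r) ×
  (colHeight S (RΛ.rook S r) ≡ n ∸ (toℕ (R2δ.col R r) / 2))

InImage : ∀ {n} → RΛ n → Set
InImage {n} S = ∃ λ (R : R2δ n) → ΠEq R S

-- Blocks: maximal sets of columns of equal height.  The block of column j
-- consists of all columns j' with the same height (columns of equal height
-- are contiguous in a Young diagram); its size is their number.

blockSize : ∀ {n} → RΛ n → Fin n → ℕ
blockSize {n} S j = count n (λ j' → colHeight S j' ≡ colHeight S j)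
                            (λ j' → colHeight S j' ℕ.≟ colHeight S j)

AllBlocksAtMost2 : ∀ {n} → RΛ n → Set
AllBlocksAtMost2 {n} S = ∀ j → blockSize S j ≤ 2

module Submission where

-- Column c of 2δ_n has height n - ⌊c/2⌋, so for each height there are exactly
-- two columns, 2k and 2k+1, distinguished by parity.  Deleting empty columns
-- keeps heights and the left-to-right order, so a block of Π_n(R) receives
-- its columns from one such pair and has size at most 2.  Conversely, when all
-- blocks have size at most 2, send the first column of the block of height h
-- to column 2(n - h) of 2δ_n and a second one to 2(n - h) + 1.  This map is
-- strictly increasing and keeps heights, so moving every rook along it gives a
-- placement on 2δ_n whose image under Π_n is the given one.

open import Defs
open import Data.Nat using (ℕ; _≤_)
open import Function.Bundles using (_⇔_; mk⇔)

open import Data.Nat as ℕ using (suc; _+_; _*_; _∸_; _/_; s≤s; NonZero)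
import Data.Nat.Properties as ℕ
open import Data.Nat.Divisibility using (divides)
open import Data.Nat.DivMod using (_mod_; _divMod_; module DivMod; m<n⇒m/n≡0; m*n/n≡m; +-distrib-/-∣ʳ; m<n*o⇒m/o<n)
open import Data.Fin as Fin using (Fin; zero; suc; toℕ; fromℕ<; inject≤)
import Data.Fin.Properties as Fin
open import Data.List using (List; length; filter; allFin; lookup)
open import Data.List.Relation.Unary.All.Properties using (all-filter)
import Data.List.Relation.Unary.All as All
open import Data.List.Relation.Unary.Any using (index)
open import Data.List.Relation.Unary.AllPairs using (_∷_)
open import Data.List.Relation.Unary.Unique.Propositional using (Unique)
import Data.List.Relation.Unary.Unique.Propositional.Properties as Unique
open import Data.List.Membership.Propositional using (_∈_)
open import Data.List.Membership.Propositional.Properties using (∈-lookup; ∈-filter⁺; ∈-allFin)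
open import Data.List.Membership.Setoid.Properties using (index-injective)
open import Data.List.Properties using (filter-≐)
open import Data.Product using (∃; _×_; _,_; proj₁; proj₂)
open import Data.Sum using (inj₁; inj₂)
open import Function.Definitions using (Injective)
open import Relation.Binary using (tri<; tri≈; tri>)
open import Relation.Binary.PropositionalEquality
open import Relation.Nullary using (Dec; yes; no; ¬_; contradiction)
open import Relation.Nullary.Decidable using (_×-dec_)

lookup-injective : ∀ {a} {A : Set a} {xs : List A} → Unique xs →
                   ∀ i j → lookup xs i ≡ lookup xs j → i ≡ j
lookup-injective (_    ∷ _) zero    zero    _  = refl
lookup-injective (x∉xs ∷ _) zero    (suc j) eq = contradiction eq (All.lookup x∉xs (∈-lookup j))
lookup-injective (x∉xs ∷ _) (suc i) zero    eq = contradiction (sym eq) (All.lookup x∉xs (∈-lookup i))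
lookup-injective (_    ∷ u) (suc i) (suc j) eq = cong suc (lookup-injective u i j eq)

module _ {n : ℕ} {P : Fin n → Set} (P? : ∀ i → Dec (P i)) where

  count≤ : ∀ {m} (g : ∀ i → P i → Fin m) →
           (∀ {i j} (p : P i) (q : P j) → g i p ≡ g j q → i ≡ j) →
           count n P P? ≤ m
  count≤ g g-inj = Fin.injective⇒≤ {f = λ k → g _ (satisfies k)}
    λ {k} {l} eq → lookup-injective unique k l (g-inj (satisfies k) (satisfies l) eq)
    where
    unique : Unique (filter P? (allFin n))
    unique = Unique.filter⁺ P? (Unique.allFin⁺ n)
    satisfies : ∀ k → P (lookup (filter P? (allFin n)) k)
    satisfies k = All.lookup (all-filter P? (allFin n)) (∈-lookup k)

  ≤count : ∀ {m} (g : Fin m → Fin n) → (∀ k → P (g k)) → Injective _≡_ _≡_ g →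
           m ≤ count n P P?
  ≤count g Pg g-inj = Fin.injective⇒≤ {f = λ k → index (member k)}
    λ {k} {l} eq → g-inj (index-injective (setoid (Fin n)) (member k) (member l) eq)
    where
    member : ∀ k → g k ∈ filter P? (allFin n)
    member k = ∈-filter⁺ P? (∈-allFin (g k)) (Pg k)

count-≐ : ∀ {n} {P Q : Fin n → Set} (P? : ∀ i → Dec (P i)) (Q? : ∀ i → Dec (Q i)) →
          (∀ {i} → P i → Q i) → (∀ {i} → Q i → P i) → count n P P? ≡ count n Q Q?
count-≐ {n} P? Q? P⇒Q Q⇒P = cong length (filter-≐ P? Q? (P⇒Q , Q⇒P) (allFin n))

section-injective : ∀ {n} {σ τ : Fin n → Fin n} → (∀ c → σ (τ c) ≡ c) → Injective _≡_ _≡_ τ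
section-injective {σ = σ} {τ} στ {a} {b} eq = trans (sym (στ a)) (trans (cong σ eq) (στ b))

count-below : ∀ {n} (σ : Fin n → Fin n) → Injective _≡_ _≡_ σ → (surj : ∀ c → ∃ λ r → σ r ≡ c) →
              ∀ c (P? : ∀ r → Dec (σ r Fin.< c)) → count n (λ r → σ r Fin.< c) P? ≡ toℕ c
count-below {n} σ σ-inj surj c P? = ℕ.≤-antisym
  (count≤ P? (λ _ σr<c → fromℕ< σr<c)
             (λ σr<c σs<c eq → σ-inj (Fin.toℕ-injective (Fin.fromℕ<-injective _ _ σr<c σs<c eq))))
  (≤count P? (λ k → σ⁻¹ (embed k))
             (λ k → subst (Fin._< c) (sym (σσ⁻¹ (embed k)))
                          (subst (ℕ._< toℕ c) (sym (Fin.toℕ-inject≤ k c≤n)) (Fin.toℕ<n k)))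
             (λ eq → Fin.inject≤-injective c≤n c≤n _ _ (section-injective {σ = σ} {σ⁻¹} σσ⁻¹ eq)))
  where
  σ⁻¹ : Fin n → Fin n
  σ⁻¹ d = proj₁ (surj d)
  σσ⁻¹ : ∀ d → σ (σ⁻¹ d) ≡ d
  σσ⁻¹ d = proj₂ (surj d)
  c≤n : toℕ c ≤ n
  c≤n = ℕ.<⇒≤ (Fin.toℕ<n c)
  embed : Fin (toℕ c) → Fin n
  embed k = inject≤ k c≤n

module _ {n : ℕ} {f : Fin n → ℕ} (f-mono : ∀ {i j} → i Fin.< j → f i ℕ.< f j) where

  strictMono⇒injective : ∀ {i j} → f i ≡ f j → i ≡ j
  strictMono⇒injective {i} {j} eq with Fin.<-cmp i j
  ... | tri< i<j _ _ = contradiction eq (ℕ.<⇒≢ (f-mono i<j))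
  ... | tri≈ _ i≡j _ = i≡j
  ... | tri> _ _ j<i = contradiction (sym eq) (ℕ.<⇒≢ (f-mono j<i))

  strictMono⇒reflects-< : ∀ {i j} → f i ℕ.< f j → i Fin.< j
  strictMono⇒reflects-< {i} {j} fi<fj with Fin.<-cmp i j
  ... | tri< i<j _ _ = i<j
  ... | tri≈ _ refl _ = contradiction fi<fj (ℕ.<-irrefl refl)
  ... | tri> _ _ j<i = contradiction fi<fj (ℕ.<-asym (f-mono j<i))

/-mod-injective : ∀ {m m′ d} .{{_ : NonZero d}} → m / d ≡ m′ / d → m mod d ≡ m′ mod d → m ≡ m′
/-mod-injective {m} {m′} {d} q r = begin
  m                              ≡⟨ DivMod.property (m divMod d) ⟩
  toℕ (m mod d) + m / d * d      ≡⟨ cong₂ (λ a b → toℕ a + b * d) r q ⟩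
  toℕ (m′ mod d) + m′ / d * d    ≡⟨ DivMod.property (m′ divMod d) ⟨
  m′                             ∎
  where open ≡-Reasoning

[b+2m]/2≡m : ∀ {b} m → b ≤ 1 → (b + 2 * m) / 2 ≡ m
[b+2m]/2≡m {b} m b≤1 = begin
  (b + 2 * m) / 2       ≡⟨ +-distrib-/-∣ʳ b (divides m (ℕ.*-comm 2 m)) ⟩
  b / 2 + 2 * m / 2     ≡⟨ cong₂ _+_ (m<n⇒m/n≡0 (s≤s b≤1)) (cong (_/ 2) (ℕ.*-comm 2 m)) ⟩
  m * 2 / 2             ≡⟨ m*n/n≡m m 2 ⟩
  m                     ∎
  where open ≡-Reasoning

b+2m<2n : ∀ {b m n} → b ≤ 1 → m ℕ.< n → b + 2 * m ℕ.< 2 * n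
b+2m<2n {b} {m} {n} b≤1 m<n = begin-strict
  b + 2 * m   ≤⟨ ℕ.+-monoˡ-≤ (2 * m) b≤1 ⟩
  1 + 2 * m   <⟨ ℕ.n<1+n _ ⟩
  2 + 2 * m   ≡⟨ ℕ.*-suc 2 m ⟨
  2 * suc m   ≤⟨ ℕ.*-monoʳ-≤ 2 m<n ⟩
  2 * n       ∎
  where open ℕ.≤-Reasoning

image⇒blocks≤2 : ∀ {n} (S : RΛ n) → InImage S → AllBlocksAtMost2 S
image⇒blocks≤2 {n} S (R , R↦S) j = count≤ _ (λ c _ → column c mod 2) parity-injective
  where
  rowOf : Fin n → Fin n
  rowOf c = proj₁ (RΛ.surj S c)
  rook-rowOf : ∀ c → RΛ.rook S (rowOf c) ≡ c
  rook-rowOf c = proj₂ (RΛ.surj S c)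
  column : Fin n → ℕ
  column c = toℕ (R2δ.col R (rowOf c))
  height-column : ∀ c → colHeight S c ≡ n ∸ column c / 2
  height-column c = trans (cong (colHeight S) (sym (rook-rowOf c))) (proj₂ (R↦S (rowOf c)))
  column/2≤n : ∀ c → column c / 2 ≤ n
  column/2≤n c = ℕ.<⇒≤ (m<n*o⇒m/o<n (subst (column c ℕ.<_) (ℕ.*-comm 2 n) (Fin.toℕ<n _)))
  parity-injective : ∀ {c c′} → colHeight S c ≡ colHeight S j → colHeight S c′ ≡ colHeight S j →
                     column c mod 2 ≡ column c′ mod 2 → c ≡ c′
  parity-injective {c} {c′} hc hc′ parity = section-injective {σ = RΛ.rook S} rook-rowOf
    (R2δ.inj R (Fin.toℕ-injective (/-mod-injective halves parity)))
    where
    halves : column c / 2 ≡ column c′ / 2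
    halves = ℕ.∸-cancelˡ-≡ (column/2≤n c) (column/2≤n c′)
      (trans (sym (height-column c)) (trans hc (trans (sym hc′) (height-column c′))))

indicator : ∀ {a} {A : Set a} → Dec A → ℕ
indicator (yes _) = 1
indicator (no _)  = 0

indicator≤1 : ∀ {a} {A : Set a} (a? : Dec A) → indicator a? ≤ 1
indicator≤1 (yes _) = ℕ.≤-refl
indicator≤1 (no _)  = ℕ.z≤n

indicator-yes : ∀ {a} {A : Set a} (a? : Dec A) → A → indicator a? ≡ 1
indicator-yes (yes _) _ = refl
indicator-yes (no ¬a) a = contradiction a ¬a

indicator-no : ∀ {a} {A : Set a} (a? : Dec A) → ¬ A → indicator a? ≡ 0
indicator-no (yes a) ¬a = contradiction a ¬a
indicator-no (no _)  _  = refl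

module FromBlocks {n : ℕ} (S : RΛ n) (blocks≤2 : AllBlocksAtMost2 S) where

  open RΛ S using (rook; shape)

  h : Fin n → ℕ
  h = colHeight S

  between-sameHeight : ∀ {i c j} → toℕ i ≤ toℕ c → toℕ c ≤ toℕ j → h i ≡ h j → h c ≡ h i
  between-sameHeight {i} {c} i≤c c≤j hi≡hj = ℕ.≤-antisym (Λ.weakDec shape i c i≤c)
    (subst (_≤ h c) (sym hi≡hj) (Λ.weakDec shape c _ c≤j))

  equalHeight⇒adjacent : ∀ {i j} → toℕ i ≤ toℕ j → h i ≡ h j → toℕ j ≤ suc (toℕ i)
  equalHeight⇒adjacent {i} {j} i≤j hi≡hj = begin
    toℕ j                    ≤⟨ ℕ.m≤n+m∸n (toℕ j) (toℕ i) ⟩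
    toℕ i + (toℕ j ∸ toℕ i)  ≤⟨ ℕ.+-monoʳ-≤ (toℕ i) (ℕ.s≤s⁻¹ interval≤2) ⟩
    toℕ i + 1                ≡⟨ ℕ.+-comm (toℕ i) 1 ⟩
    suc (toℕ i)              ∎
    where
    open ℕ.≤-Reasoning
    i+k≤j : (k : Fin (suc (toℕ j ∸ toℕ i))) → toℕ i + toℕ k ≤ toℕ j
    i+k≤j k = ℕ.≤-trans (ℕ.+-monoʳ-≤ (toℕ i) (ℕ.s≤s⁻¹ (Fin.toℕ<n k))) (ℕ.≤-reflexive (ℕ.m+[n∸m]≡n i≤j))
    shift : Fin (suc (toℕ j ∸ toℕ i)) → Fin n
    shift k = fromℕ< (ℕ.≤-<-trans (i+k≤j k) (Fin.toℕ<n j))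
    toℕ-shift : ∀ k → toℕ (shift k) ≡ toℕ i + toℕ k
    toℕ-shift k = Fin.toℕ-fromℕ< _
    shift-sameHeight : ∀ k → h (shift k) ≡ h i
    shift-sameHeight k = between-sameHeight
      (subst (toℕ i ≤_) (sym (toℕ-shift k)) (ℕ.m≤m+n (toℕ i) (toℕ k)))
      (subst (_≤ toℕ j) (sym (toℕ-shift k)) (i+k≤j k))
      hi≡hj
    shift-injective : Injective _≡_ _≡_ shift
    shift-injective {k} {l} eq = Fin.toℕ-injective (ℕ.+-cancelˡ-≡ (toℕ i) _ _
      (trans (sym (toℕ-shift k)) (trans (cong toℕ eq) (toℕ-shift l))))
    interval≤2 : suc (toℕ j ∸ toℕ i) ≤ 2
    interval≤2 = ℕ.≤-trans (≤count _ shift shift-sameHeight shift-injective) (blocks≤2 i)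

  HasLeftTwin : Fin n → Set
  HasLeftTwin j = ∃ λ i → suc (toℕ i) ≡ toℕ j × h i ≡ h j

  hasLeftTwin? : ∀ j → Dec (HasLeftTwin j)
  hasLeftTwin? j = Fin.any? λ i → (suc (toℕ i) ℕ.≟ toℕ j) ×-dec (h i ℕ.≟ h j)

  later⇒hasLeftTwin : ∀ {i j} → i Fin.< j → h i ≡ h j → HasLeftTwin j
  later⇒hasLeftTwin {i} i<j hi≡hj =
    i , ℕ.≤-antisym i<j (equalHeight⇒adjacent (ℕ.<⇒≤ i<j) hi≡hj) , hi≡hj

  earlier⇒noLeftTwin : ∀ {i j} → i Fin.< j → h i ≡ h j → ¬ HasLeftTwin i
  earlier⇒noLeftTwin {i} {j} i<j hi≡hj (i₀ , i₀+1≡i , hi₀≡hi) = ℕ.<⇒≱ i<j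
    (subst (toℕ j ≤_) i₀+1≡i (equalHeight⇒adjacent i₀≤j (trans hi₀≡hi hi≡hj)))
    where
    i₀≤j : toℕ i₀ ≤ toℕ j
    i₀≤j = ℕ.<⇒≤ (ℕ.<-trans (subst (toℕ i₀ ℕ.<_) i₀+1≡i (ℕ.n<1+n (toℕ i₀))) i<j)

  offset : Fin n → ℕ
  offset j = indicator (hasLeftTwin? j)

  offset≤1 : ∀ j → offset j ≤ 1
  offset≤1 j = indicator≤1 (hasLeftTwin? j)

  target : Fin n → ℕ
  target j = offset j + 2 * (n ∸ h j)

  target-strictMono : ∀ {i j} → i Fin.< j → target i ℕ.< target j
  target-strictMono {i} {j} i<j with ℕ.m≤n⇒m<n∨m≡n (Λ.weakDec shape i j (ℕ.<⇒≤ i<j))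
  ... | inj₁ hj<hi = ℕ.<-≤-trans
    (b+2m<2n (offset≤1 i) (ℕ.∸-monoʳ-< hj<hi (Λ.bounded shape i)))
    (ℕ.m≤n+m (2 * (n ∸ h j)) (offset j))
  ... | inj₂ hj≡hi = begin-strict
    target i           ≡⟨ cong (_+ 2 * (n ∸ h i)) (indicator-no (hasLeftTwin? i) (earlier⇒noLeftTwin i<j (sym hj≡hi))) ⟩
    2 * (n ∸ h i)      <⟨ ℕ.n<1+n _ ⟩
    1 + 2 * (n ∸ h i)  ≡⟨ cong₂ (λ b k → b + 2 * (n ∸ k))
                                (indicator-yes (hasLeftTwin? j) (later⇒hasLeftTwin i<j (sym hj≡hi))) hj≡hi ⟨
    target j           ∎
    where open ℕ.≤-Reasoning

  target<2n : ∀ j → target j ℕ.< 2 * n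
  target<2n j = b+2m<2n (offset≤1 j) (ℕ.∸-monoʳ-< (Λ.positive shape j) (Λ.bounded shape j))

  column : Fin n → Fin (2 * n)
  column r = fromℕ< (target<2n (rook r))

  toℕ-column : ∀ r → toℕ (column r) ≡ target (rook r)
  toℕ-column r = Fin.toℕ-fromℕ< _

  placement : R2δ n
  placement = record
    { col    = column
    ; inj    = λ {r} {s} eq → RΛ.inj S (strictMono⇒injective target-strictMono
                 (trans (sym (toℕ-column r)) (trans (cong toℕ eq) (toℕ-column s))))
    ; inside = λ r → subst (ℕ._< _) (sym (toℕ-column r))
                 (b+2m<2n (offset≤1 (rook r)) (ℕ.∸-monoʳ-< (RΛ.inside S r) (Λ.bounded shape (rook r))))
    }

  rank-placement : ∀ r → toℕ (rook r) ≡ rank placement r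
  rank-placement r = sym (trans (count-≐ _ (λ r′ → rook r′ Fin.<? rook r) reflect preserve)
                                (count-below rook (RΛ.inj S) (RΛ.surj S) (rook r) _))
    where
    reflect : ∀ {r′} → toℕ (column r′) ℕ.< toℕ (column r) → rook r′ Fin.< rook r
    reflect {r′} lt = strictMono⇒reflects-< target-strictMono
      (subst₂ ℕ._<_ (toℕ-column r′) (toℕ-column r) lt)
    preserve : ∀ {r′} → rook r′ Fin.< rook r → toℕ (column r′) ℕ.< toℕ (column r)
    preserve {r′} lt = subst₂ ℕ._<_ (sym (toℕ-column r′)) (sym (toℕ-column r)) (target-strictMono lt)

  height-placement : ∀ r → colHeight S (rook r) ≡ n ∸ toℕ (column r) / 2
  height-placement r = begin
    h (rook r)                ≡⟨ ℕ.m∸[m∸n]≡n (Λ.bounded shape (rook r)) ⟨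
    n ∸ (n ∸ h (rook r))      ≡⟨ cong (n ∸_) ([b+2m]/2≡m (n ∸ h (rook r)) (offset≤1 (rook r))) ⟨
    n ∸ target (rook r) / 2   ≡⟨ cong (λ x → n ∸ x / 2) (toℕ-column r) ⟨
    n ∸ toℕ (column r) / 2    ∎
    where open ≡-Reasoning

  blocks≤2⇒image : InImage S
  blocks≤2⇒image = placement , λ r → rank-placement r , height-placement r

proposition2p2 : (n : ℕ) → 1 ≤ n → (S : RΛ n) → InImage S ⇔ AllBlocksAtMost2 S
proposition2p2 n _ S = mk⇔ (image⇒blocks≤2 S) (FromBlocks.blocks≤2⇒image S)
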